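{- Let $\mathcal P_1,\mathcal P_2$ be finite posets. (i) If $\mathcal P=\mathcal P_1+\mathcal P_2$ is their disjoint union, then $\mathcal K^{u}_{\mathcal P}=\mathcal K^{u}_{\mathcal P_1}+\mathcal K^{u}_{\mathcal P_2}$, $\mathcal K^{l}_{\mathcal P}=\mathcal K^{l}_{\mathcal P_1}+\mathcal K^{l}_{\mathcal P_2}$ and $D_{\mathcal P}=D_{\mathcal P_1}+D_{\mathcal P_2}$. (ii) If $\mathcal P=\mathcal P_1\times\mathcal P_2$ is their direct (componentwise) product, then $\mathcal K^{u}_{\mathcal P}=\mathcal K^{u}_{\mathcal P_1}\mathcal K^{u}_{\mathcal P_2}$, $\mathcal K^{l}_{\mathcal P}=\mathcal K^{l}_{\mathcal P_1}\mathcal K^{l}_{\mathcal P_2}$, and $D_{\mathcal P}=\mathcal K^{u}_{\mathcal P_1}D_{\mathcal P_2}+\mathcal K^{l}_{\mathcal P_2}D_{\mathcal P_1}=\mathcal K^{l}_{\mathcal P_1}D_{\mathcal P_2}+\mathcal K^{u}_{\mathcal P_2}D_{\mathcal P_1}$.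
   Context: For a finite poset $(\mathcal P,\preccurlyeq)$ and $x\in\mathcal P$, let $\kappa(x)$ be the number of elements of $\mathcal P$ covered by $x$ and $\iota(x)$ the number of elements of $\mathcal P$ that cover $x$. The upper covering polynomial is $\mathcal K^{u}_{\mathcal P}(q)=\sum_{x\in\mathcal P}q^{\kappa(x)}$ and the lower covering polynomial is $\mathcal K^{l}_{\mathcal P}(q)=\sum_{x\in\mathcal P}q^{\iota(x)}$. These satisfy $\mathcal K^{u}_{\mathcal P}(1)=\mathcal K^{l}_{\mathcal P}(1)$ and $(\mathcal K^{u}_{\mathcal P})'(1)=(\mathcal K^{l}_{\mathcal P})'(1)$, so $\mathcal K^{u}_{\mathcal P}(q)-\mathcal K^{l}_{\mathcal P}(q)=(q-1)^2D_{\mathcal P}(q)$ for a unique polynomial $D_{\mathcal P}$, the deviation polynomial of $\mathcal P$. -}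

module Defs where

open import Data.Nat as ℕ using (ℕ; zero; suc; _∸_)
open import Data.Integer as ℤ using (ℤ; +_; -_)
open import Data.List using (List; []; _∷_; _++_; map; filter; length; cartesianProduct)
open import Data.List.Membership.Propositional using (_∈_; lose)
open import Data.List.Membership.Propositional.Properties
  using (∈-map⁺; ∈-map⁻; ∈-++⁺ˡ; ∈-++⁺ʳ; ∈-cartesianProduct⁺)
open import Data.List.Relation.Unary.Any using (Any; any?)

open import Data.List.Relation.Unary.Unique.Propositional using (Unique)
import Data.List.Relation.Unary.Unique.Propositional.Properties as UniqueP
open import Data.Sum using (_⊎_; inj₁; inj₂)
open import Data.Product using (Σ; ∃; _×_; _,_; proj₁; proj₂)
open import Data.Empty using (⊥)
open import Relation.Nullary using (¬_; Dec; yes; no)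
open import Relation.Nullary.Decidable using (_×-dec_; ¬?)
open import Relation.Binary using (IsPartialOrder; IsPreorder; Decidable; DecidableEquality)
open import Relation.Binary.PropositionalEquality
  using (_≡_; _≢_; refl; sym; trans; cong; isEquivalence)

record FinPoset : Set₁ where
  field
    Carrier        : Set
    _≤_            : Carrier → Carrier → Set
    isPartialOrder : IsPartialOrder _≡_ _≤_
    _≤?_           : Decidable _≤_
    _≟_            : DecidableEquality Carrier
    elems          : List Carrier
    complete       : ∀ x → x ∈ elems
    unique         : Unique elems

  _<_ : Carrier → Carrier → Set
  x < y = x ≤ y × x ≢ y

  _<?_ : Decidable _<_
  x <? y = (x ≤? y) ×-dec ¬? (x ≟ y)

  _⋖_ : Carrier → Carrier → Set
  y ⋖ x = y < x × ¬ (Σ Carrier λ z → y < z × z < x)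

  _⋖?_ : Decidable _⋖_
  y ⋖? x with y <? x | any? (λ z → (y <? z) ×-dec (z <? x)) elems
  ... | no ¬p | _ = no λ c → ¬p (proj₁ c)
  ... | yes p | yes a = no λ c → proj₂ c (Data.List.Relation.Unary.Any.satisfied a)
  ... | yes p | no ¬a = yes (p , λ { (z , q) → ¬a (lose (complete z) q) })

  κ : Carrier → ℕ
  κ x = length (filter (λ y → y ⋖? x) elems)

  ι : Carrier → ℕ
  ι x = length (filter (λ y → x ⋖? y) elems)

-- Polynomials with integer coefficients, as coefficient sequences
-- (p k = coefficient of q^k), compared coefficientwise.

Poly : Set
Poly = ℕ → ℤ

infix 4 _≈_
_≈_ : Poly → Poly → Set
p ≈ r = ∀ k → p k ≡ r k

infixl 6 _⊕_ _⊖_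
infixl 7 _⊛_

_⊕_ : Poly → Poly → Poly
(p ⊕ r) k = p k ℤ.+ r k

_⊖_ : Poly → Poly → Poly
(p ⊖ r) k = p k ℤ.- r k

sumTo : (ℕ → ℤ) → ℕ → ℤ
sumTo f zero    = f zero
sumTo f (suc n) = sumTo f n ℤ.+ f (suc n)

_⊛_ : Poly → Poly → Poly
(p ⊛ r) k = sumTo (λ i → p i ℤ.* r (k ∸ i)) k

-- the polynomial (q - 1)^2 = 1 - 2q + q^2
qMinus1Sq : Poly
qMinus1Sq 0 = + 1
qMinus1Sq 1 = - (+ 2)
qMinus1Sq 2 = + 1
qMinus1Sq (suc (suc (suc _))) = + 0

module _ (P : FinPoset) where
  open FinPoset P

  -- upper covering polynomial  K^u_P(q) = Σ_x q^{κ(x)}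
  Ku : Poly
  Ku k = + length (filter (λ x → κ x ℕ.≟ k) elems)

  -- lower covering polynomial  K^l_P(q) = Σ_x q^{ι(x)}
  Kl : Poly
  Kl k = + length (filter (λ x → ι x ℕ.≟ k) elems)

  IsDeviation : Poly → Set
  IsDeviation D = Ku ⊖ Kl ≈ qMinus1Sq ⊛ D

module _ {A B : Set} (_≤₁_ : A → A → Set) (_≤₂_ : B → B → Set) where
  SumLe : A ⊎ B → A ⊎ B → Set
  SumLe (inj₁ a) (inj₁ a') = a ≤₁ a'
  SumLe (inj₂ b) (inj₂ b') = b ≤₂ b'
  SumLe (inj₁ _) (inj₂ _)  = ⊥
  SumLe (inj₂ _) (inj₁ _)  = ⊥

  ProdLe : A × B → A × B → Set
  ProdLe (a , b) (a' , b') = a ≤₁ a' × b ≤₂ b'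

inj₁-injective : {A B : Set} {x y : A} → inj₁ {B = B} x ≡ inj₁ y → x ≡ y
inj₁-injective refl = refl

inj₂-injective : {A B : Set} {x y : B} → inj₂ {A = A} x ≡ inj₂ y → x ≡ y
inj₂-injective refl = refl

_⊎ₚ_ : FinPoset → FinPoset → FinPoset
P₁ ⊎ₚ P₂ = record
  { Carrier        = P₁.Carrier ⊎ P₂.Carrier
  ; _≤_            = SumLe P₁._≤_ P₂._≤_
  ; isPartialOrder = record
      { isPreorder = record
          { isEquivalence = isEquivalence
          ; reflexive     = refl′
          ; trans         = λ {i j k} → trans′ {i} {j} {k}
          }
      ; antisym = λ {i j} → antisym′ {i} {j}
      }
  ; _≤?_     = dec
  ; _≟_      = eq
  ; elems    = map inj₁ P₁.elems ++ map inj₂ P₂.elems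
  ; complete = compl
  ; unique   = UniqueP.++⁺ (UniqueP.map⁺ inj₁-injective P₁.unique)
                           (UniqueP.map⁺ inj₂-injective P₂.unique) disj
  }
  where
  module P₁ = FinPoset P₁
  module P₂ = FinPoset P₂
  module O₁ = IsPartialOrder P₁.isPartialOrder
  module O₂ = IsPartialOrder P₂.isPartialOrder
  C = P₁.Carrier ⊎ P₂.Carrier
  _≤_ = SumLe P₁._≤_ P₂._≤_

  refl′ : ∀ {x y : C} → x ≡ y → x ≤ y
  refl′ {inj₁ a} refl = O₁.refl
  refl′ {inj₂ b} refl = O₂.refl

  trans′ : ∀ {x y z : C} → x ≤ y → y ≤ z → x ≤ z
  trans′ {inj₁ _} {inj₁ _} {inj₁ _} p q = O₁.trans p q
  trans′ {inj₂ _} {inj₂ _} {inj₂ _} p q = O₂.trans p q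

  antisym′ : ∀ {x y : C} → x ≤ y → y ≤ x → x ≡ y
  antisym′ {inj₁ _} {inj₁ _} p q = cong inj₁ (O₁.antisym p q)
  antisym′ {inj₂ _} {inj₂ _} p q = cong inj₂ (O₂.antisym p q)

  dec : Decidable _≤_
  dec (inj₁ a) (inj₁ a') = a P₁.≤? a'
  dec (inj₂ b) (inj₂ b') = b P₂.≤? b'
  dec (inj₁ _) (inj₂ _)  = no λ ()
  dec (inj₂ _) (inj₁ _)  = no λ ()

  eq : DecidableEquality C
  eq (inj₁ a) (inj₁ a') with a P₁.≟ a'
  ... | yes refl = yes refl
  ... | no ne    = no λ e → ne (inj₁-injective e)
  eq (inj₂ b) (inj₂ b') with b P₂.≟ b'
  ... | yes refl = yes refl
  ... | no ne    = no λ e → ne (inj₂-injective e)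
  eq (inj₁ _) (inj₂ _) = no λ ()
  eq (inj₂ _) (inj₁ _) = no λ ()

  compl : ∀ x → x ∈ map inj₁ P₁.elems ++ map inj₂ P₂.elems
  compl (inj₁ a) = ∈-++⁺ˡ (∈-map⁺ inj₁ (P₁.complete a))
  compl (inj₂ b) = ∈-++⁺ʳ (map inj₁ P₁.elems) (∈-map⁺ inj₂ (P₂.complete b))

  disj : ∀ {v} → ¬ (v ∈ map inj₁ P₁.elems × v ∈ map inj₂ P₂.elems)
  disj (p , q) with ∈-map⁻ inj₁ p | ∈-map⁻ inj₂ q
  ... | _ , _ , refl | _ , _ , ()

_×ₚ_ : FinPoset → FinPoset → FinPoset
P₁ ×ₚ P₂ = record
  { Carrier        = P₁.Carrier × P₂.Carrier
  ; _≤_            = ProdLe P₁._≤_ P₂._≤_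
  ; isPartialOrder = record
      { isPreorder = record
          { isEquivalence = isEquivalence
          ; reflexive     = λ { refl → O₁.refl , O₂.refl }
          ; trans         = λ { (p , p') (q , q') → O₁.trans p q , O₂.trans p' q' }
          }
      ; antisym = λ { (p , p') (q , q') → cong₂′ (O₁.antisym p q) (O₂.antisym p' q') }
      }
  ; _≤?_     = λ { (a , b) (a' , b') → (a P₁.≤? a') ×-dec (b P₂.≤? b') }
  ; _≟_      = eq
  ; elems    = cartesianProduct P₁.elems P₂.elems
  ; complete = λ { (a , b) → ∈-cartesianProduct⁺ (P₁.complete a) (P₂.complete b) }
  ; unique   = UniqueP.cartesianProduct⁺ P₁.unique P₂.unique
  }
  where
  module P₁ = FinPoset P₁
  module P₂ = FinPoset P₂
  module O₁ = IsPartialOrder P₁.isPartialOrder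
  module O₂ = IsPartialOrder P₂.isPartialOrder

  cong₂′ : ∀ {a a' : P₁.Carrier} {b b' : P₂.Carrier} → a ≡ a' → b ≡ b' → (a , b) ≡ (a' , b')
  cong₂′ refl refl = refl

  eq : DecidableEquality (P₁.Carrier × P₂.Carrier)
  eq (a , b) (a' , b') with a P₁.≟ a' | b P₂.≟ b'
  ... | yes refl | yes refl = yes refl
  ... | no ne | _ = no λ e → ne (cong proj₁ e)
  ... | _ | no ne = no λ e → ne (cong proj₂ e)

-- Both covering polynomials are generating functions Σₓ q^{f x} of a degree
-- function f on the elements.  In P₁ + P₂ the covers of an element all lie in
-- its own summand, so κ and ι restrict to the summands and the generating
-- functions add.  In P₁ × P₂ an element (a′, b′) is covered by (a, b) exactly
-- when one coordinate is covered and the other is equal, so κ(a, b) = κ a + κ b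
-- (likewise ι), and a generating function of a sum of degrees over a product set
-- is the product of the generating functions.  The deviation identities then
-- follow from  U₁U₂ − L₁L₂ = U₁(U₂ − L₂) + L₂(U₁ − L₁),  since (q − 1)² is not a
-- zero divisor: (q − 1)² X = (q − 1)² Y forces X = Y by recovering the
-- coefficients of X one at a time from its second differences.
module Submission where

open import Defs
open import Data.Nat as ℕ using (ℕ; zero; suc; _∸_; z≤n)
import Data.Nat.Properties as ℕP
open import Data.Nat.Induction using (<-rec)
open import Data.Integer using (ℤ; +_; -_; _+_; _-_; _*_)
import Data.Integer.Properties as ℤP
open import Data.Integer.Tactic.RingSolver using (solve-∀)
open import Data.List using (List; []; _∷_; _++_; map; filter; length; cartesianProduct)
open import Data.List.Properties using (filter-++; filter-≐; filter-none; filter-accept; filter-reject; length-++)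
open import Data.List.Membership.Propositional using (_∈_)
open import Data.List.Relation.Unary.Any using (here; there)
import Data.List.Relation.Unary.All as All
open import Data.List.Relation.Unary.Unique.Propositional using (Unique)
open import Data.List.Relation.Unary.AllPairs using (_∷_)
open import Data.Product using (_×_; _,_; proj₁; proj₂)
open import Data.Sum using (_⊎_; inj₁; inj₂)
open import Data.Bool using (true; false)
open import Data.Empty using (⊥-elim)
open import Function using (_∘_)
open import Relation.Nullary using (¬_; yes; no; does)
open import Relation.Unary as U using (Pred; _≐_; _⊥_)
open import Relation.Unary.Properties using (_∪?_; _×?_)
open import Relation.Binary using (IsPartialOrder; DecidableEquality)
open import Relation.Binary.PropositionalEquality
open import Level using (Level)
import Relation.Binary.Reasoning.Setoid (ℕ →-setoid ℤ) as ≈-Reasoning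

private
  variable
    A B : Set
    ℓ ℓ′ : Level

-- Polynomials

0ₚ : Poly
0ₚ _ = + 0

shift : Poly → Poly
shift p zero    = + 0
shift p (suc k) = p k

q^_ : ℕ → Poly
(q^ zero)    zero    = + 1
(q^ zero)    (suc k) = + 0
(q^ (suc u)) zero    = + 0
(q^ (suc u)) (suc k) = (q^ u) k

Δ² : Poly → Poly
Δ² p = p ⊖ (shift p ⊕ shift p) ⊕ shift (shift p)

≈-refl : ∀ {p} → p ≈ p
≈-refl _ = refl

≈-sym : ∀ {p r} → p ≈ r → r ≈ p
≈-sym h k = sym (h k)

≈-trans : ∀ {p r s} → p ≈ r → r ≈ s → p ≈ s
≈-trans h h′ k = trans (h k) (h′ k)

⊕-cong : ∀ {p p′ r r′} → p ≈ p′ → r ≈ r′ → p ⊕ r ≈ p′ ⊕ r′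
⊕-cong hp hr k = cong₂ _+_ (hp k) (hr k)

⊖-cong : ∀ {p p′ r r′} → p ≈ p′ → r ≈ r′ → p ⊖ r ≈ p′ ⊖ r′
⊖-cong hp hr k = cong₂ _-_ (hp k) (hr k)

⊕-comm : ∀ p r → p ⊕ r ≈ r ⊕ p
⊕-comm p r k = ℤP.+-comm (p k) (r k)

shift-cong : ∀ {p r} → p ≈ r → shift p ≈ shift r
shift-cong h zero    = refl
shift-cong h (suc k) = h k

q^-suc : ∀ u → q^ (suc u) ≈ shift (q^ u)
q^-suc u zero    = refl
q^-suc u (suc k) = refl

sumTo-cong : ∀ {f g} k → (∀ {i} → i ℕ.≤ k → f i ≡ g i) → sumTo f k ≡ sumTo g k
sumTo-cong zero    h = h z≤n
sumTo-cong (suc k) h = cong₂ _+_ (sumTo-cong k (h ∘ ℕP.m≤n⇒m≤1+n)) (h ℕP.≤-refl)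

sumTo-zero : ∀ {f} k → (∀ {i} → i ℕ.≤ k → f i ≡ + 0) → sumTo f k ≡ + 0
sumTo-zero zero    h = h z≤n
sumTo-zero (suc k) h = cong₂ _+_ (sumTo-zero k (h ∘ ℕP.m≤n⇒m≤1+n)) (h ℕP.≤-refl)

sumTo-+ : ∀ f g k → sumTo (λ i → f i + g i) k ≡ sumTo f k + sumTo g k
sumTo-+ f g zero    = refl
sumTo-+ f g (suc k) =
  trans (cong (_+ (f (suc k) + g (suc k))) (sumTo-+ f g k))
        (interchange (sumTo f k) (sumTo g k) (f (suc k)) (g (suc k)))
  where
  interchange : ∀ a b c d → a + b + (c + d) ≡ a + c + (b + d)
  interchange = solve-∀

sumTo-suc : ∀ f k → sumTo f (suc k) ≡ f 0 + sumTo (f ∘ suc) k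
sumTo-suc f zero    = refl
sumTo-suc f (suc k) =
  trans (cong (_+ f (suc (suc k))) (sumTo-suc f k)) (ℤP.+-assoc (f 0) _ _)

sumTo-reverse : ∀ f k → sumTo f k ≡ sumTo (λ i → f (k ∸ i)) k
sumTo-reverse f zero    = refl
sumTo-reverse f (suc k) = begin
  sumTo f k + f (suc k)                   ≡⟨ ℤP.+-comm _ (f (suc k)) ⟩
  f (suc k) + sumTo f k                   ≡⟨ cong (λ t → f (suc k) + t) (sumTo-reverse f k) ⟩
  f (suc k) + sumTo (λ i → f (k ∸ i)) k   ≡⟨ sumTo-suc (λ i → f (suc k ∸ i)) k ⟨
  sumTo (λ i → f (suc k ∸ i)) (suc k)     ∎
  where open ≡-Reasoning

⊛-cong : ∀ {p p′ r r′} → p ≈ p′ → r ≈ r′ → p ⊛ r ≈ p′ ⊛ r′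
⊛-cong hp hr k = sumTo-cong k (λ {i} _ → cong₂ _*_ (hp i) (hr (k ∸ i)))

⊛-comm : ∀ p r → p ⊛ r ≈ r ⊛ p
⊛-comm p r k = trans (sumTo-reverse _ k) (sumTo-cong k λ {i} i≤k →
  trans (cong (λ j → p (k ∸ i) * r j) (ℕP.m∸[m∸n]≡n i≤k)) (ℤP.*-comm (p (k ∸ i)) (r i)))

⊛-distribˡ-⊕ : ∀ p r s → p ⊛ (r ⊕ s) ≈ p ⊛ r ⊕ p ⊛ s
⊛-distribˡ-⊕ p r s k =
  trans (sumTo-cong k (λ {i} _ → ℤP.*-distribˡ-+ (p i) _ _)) (sumTo-+ _ _ k)

⊛-distribʳ-⊕ : ∀ p r s → (p ⊕ r) ⊛ s ≈ p ⊛ s ⊕ r ⊛ s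
⊛-distribʳ-⊕ p r s =
  ≈-trans (⊛-comm (p ⊕ r) s)
    (≈-trans (⊛-distribˡ-⊕ s p r) (⊕-cong (⊛-comm s p) (⊛-comm s r)))

⊛-distribˡ-⊖ : ∀ p r s → p ⊛ (r ⊖ s) ≈ p ⊛ r ⊖ p ⊛ s
⊛-distribˡ-⊖ p r s k =
  subtract (trans (sym (⊛-distribˡ-⊕ p (r ⊖ s) s k)) (⊛-cong {p} ≈-refl (λ j → sub-add (r j) (s j)) k))
  where
  sub-add : ∀ a b → a - b + b ≡ a
  sub-add = solve-∀
  add-sub : ∀ a b → a + b - b ≡ a
  add-sub = solve-∀
  subtract : ∀ {a b c} → a + b ≡ c → a ≡ c - b
  subtract {a} {b} refl = sym (add-sub a b)

⊛-zeroˡ : ∀ p → 0ₚ ⊛ p ≈ 0ₚ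
⊛-zeroˡ p k = sumTo-zero k (λ {i} _ → ℤP.*-zeroˡ (p (k ∸ i)))

⊛-zeroʳ : ∀ p → p ⊛ 0ₚ ≈ 0ₚ
⊛-zeroʳ p = ≈-trans (⊛-comm p 0ₚ) (⊛-zeroˡ p)

⊛-identityˡ : ∀ p → q^ 0 ⊛ p ≈ p
⊛-identityˡ p zero    = ℤP.*-identityˡ (p 0)
⊛-identityˡ p (suc k) = begin
  sumTo (λ i → (q^ 0) i * p (suc k ∸ i)) (suc k)
    ≡⟨ sumTo-suc _ k ⟩
  + 1 * p (suc k) + sumTo (λ i → + 0 * p (k ∸ i)) k
    ≡⟨ cong₂ _+_ (ℤP.*-identityˡ (p (suc k))) (sumTo-zero k (λ {i} _ → ℤP.*-zeroˡ (p (k ∸ i)))) ⟩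
  p (suc k) + + 0
    ≡⟨ ℤP.+-identityʳ (p (suc k)) ⟩
  p (suc k) ∎
  where open ≡-Reasoning

⊛-shift : ∀ p r → p ⊛ shift r ≈ shift (p ⊛ r)
⊛-shift p r zero    = ℤP.*-zeroʳ (p 0)
⊛-shift p r (suc k) = begin
  sumTo (λ i → p i * shift r (suc k ∸ i)) k + p (suc k) * shift r (k ∸ k)
    ≡⟨ cong₂ _+_ (sumTo-cong k (λ {i} i≤k → cong (λ j → p i * shift r j) (ℕP.+-∸-assoc 1 i≤k)))
                 (trans (cong (λ j → p (suc k) * shift r j) (ℕP.n∸n≡0 k)) (ℤP.*-zeroʳ (p (suc k)))) ⟩
  (p ⊛ r) k + + 0
    ≡⟨ ℤP.+-identityʳ _ ⟩
  (p ⊛ r) k ∎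
  where open ≡-Reasoning

⊛-shiftˡ : ∀ p r → shift p ⊛ r ≈ shift (p ⊛ r)
⊛-shiftˡ p r =
  ≈-trans (⊛-comm (shift p) r) (≈-trans (⊛-shift r p) (shift-cong (⊛-comm r p)))

q^-+ : ∀ u v → q^ (u ℕ.+ v) ≈ q^ u ⊛ q^ v
q^-+ zero    v = ≈-sym (⊛-identityˡ (q^ v))
q^-+ (suc u) v = begin
  q^ (suc (u ℕ.+ v))        ≈⟨ q^-suc (u ℕ.+ v) ⟩
  shift (q^ (u ℕ.+ v))      ≈⟨ shift-cong (q^-+ u v) ⟩
  shift (q^ u ⊛ q^ v)       ≈⟨ ⊛-shiftˡ (q^ u) (q^ v) ⟨
  shift (q^ u) ⊛ q^ v       ≈⟨ ⊛-cong {q^ (suc u)} {shift (q^ u)} {q^ v} (q^-suc u) ≈-refl ⟨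
  q^ (suc u) ⊛ q^ v         ∎
  where open ≈-Reasoning

⊛-Δ² : ∀ p r → p ⊛ Δ² r ≈ Δ² (p ⊛ r)
⊛-Δ² p r = begin
  p ⊛ (r ⊖ (shift r ⊕ shift r) ⊕ shift (shift r))
    ≈⟨ ⊛-distribˡ-⊕ p (r ⊖ (shift r ⊕ shift r)) (shift (shift r)) ⟩
  p ⊛ (r ⊖ (shift r ⊕ shift r)) ⊕ p ⊛ shift (shift r)
    ≈⟨ ⊕-cong (⊛-distribˡ-⊖ p r (shift r ⊕ shift r)) ≈-refl ⟩
  p ⊛ r ⊖ p ⊛ (shift r ⊕ shift r) ⊕ p ⊛ shift (shift r)
    ≈⟨ ⊕-cong (⊖-cong {p ⊛ r} ≈-refl (⊛-distribˡ-⊕ p (shift r) (shift r))) ≈-refl ⟩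
  p ⊛ r ⊖ (p ⊛ shift r ⊕ p ⊛ shift r) ⊕ p ⊛ shift (shift r)
    ≈⟨ ⊕-cong (⊖-cong {p ⊛ r} ≈-refl (⊕-cong (⊛-shift p r) (⊛-shift p r)))
              (≈-trans (⊛-shift p (shift r)) (shift-cong (⊛-shift p r))) ⟩
  Δ² (p ⊛ r) ∎
  where open ≈-Reasoning

qMinus1Sq-⊛ : ∀ p → qMinus1Sq ⊛ p ≈ Δ² p
qMinus1Sq-⊛ p zero          = expand (p 0)
  where
  expand : ∀ a → + 1 * a ≡ a - (+ 0 + + 0) + + 0
  expand = solve-∀
qMinus1Sq-⊛ p (suc zero)    = expand (p 1) (p 0)
  where
  expand : ∀ a b → + 1 * a + - (+ 2) * b ≡ a - (b + b) + + 0
  expand = solve-∀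
qMinus1Sq-⊛ p (suc (suc m)) =
  trans (vanishing-tail m) (expand (p (2 ℕ.+ m)) (p (1 ℕ.+ m)) (p m))
  where
  term : ℕ → ℤ
  term i = qMinus1Sq i * p (suc (suc m) ∸ i)
  vanishing-tail : ∀ n → sumTo term (2 ℕ.+ n) ≡ sumTo term 2
  vanishing-tail zero    = refl
  vanishing-tail (suc n) = trans (cong (λ t → t + + 0) (vanishing-tail n)) (ℤP.+-identityʳ _)
  expand : ∀ a b c → + 1 * a + - (+ 2) * b + + 1 * c ≡ a - (b + b) + c
  expand = solve-∀

qMinus1Sq-leftComm : ∀ p r → qMinus1Sq ⊛ (p ⊛ r) ≈ p ⊛ (qMinus1Sq ⊛ r)
qMinus1Sq-leftComm p r =
  ≈-trans (qMinus1Sq-⊛ (p ⊛ r))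
    (≈-trans (≈-sym (⊛-Δ² p r)) (⊛-cong {p} ≈-refl (≈-sym (qMinus1Sq-⊛ r))))

shift-agree : ∀ {p r k} → (∀ {j} → j ℕ.< k → p j ≡ r j) → shift p k ≡ shift r k
shift-agree {k = zero}  h = refl
shift-agree {k = suc k} h = h (ℕP.n<1+n k)

-- Each coefficient of p is recovered from Δ² p and the two coefficients below it.
Δ²-injective : ∀ {p r} → Δ² p ≈ Δ² r → p ≈ r
Δ²-injective {p} {r} h = <-rec (λ k → p k ≡ r k) step
  where
  recover : ∀ a b c → a ≡ a - (b + b) + c + (b + b) - c
  recover = solve-∀
  step : ∀ k → (∀ {j} → j ℕ.< k → p j ≡ r j) → p k ≡ r k
  step k below =
    trans (recover (p k) (shift p k) (shift (shift p) k))
      (trans (cong₂ _-_ (cong₂ (λ d b → d + (b + b)) (h k) shift¹) shift²)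
        (sym (recover (r k) (shift r k) (shift (shift r) k))))
    where
    shift¹ : shift p k ≡ shift r k
    shift¹ = shift-agree below
    shift² : shift (shift p) k ≡ shift (shift r) k
    shift² = shift-agree (λ j<k → shift-agree (λ i<j → below (ℕP.<-trans i<j j<k)))

qMinus1Sq-⊛-cancel : ∀ {p r} → qMinus1Sq ⊛ p ≈ qMinus1Sq ⊛ r → p ≈ r
qMinus1Sq-⊛-cancel {p} {r} h =
  Δ²-injective (≈-trans (≈-sym (qMinus1Sq-⊛ p)) (≈-trans h (qMinus1Sq-⊛ r)))

⊕-deviation : ∀ U L D U′ L′ D′ → U ⊖ L ≈ qMinus1Sq ⊛ D → U′ ⊖ L′ ≈ qMinus1Sq ⊛ D′ →
              (U ⊕ U′) ⊖ (L ⊕ L′) ≈ qMinus1Sq ⊛ (D ⊕ D′)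
⊕-deviation U L D U′ L′ D′ h h′ = begin
  (U ⊕ U′) ⊖ (L ⊕ L′)               ≈⟨ (λ k → regroup (U k) (U′ k) (L k) (L′ k)) ⟩
  (U ⊖ L) ⊕ (U′ ⊖ L′)               ≈⟨ ⊕-cong h h′ ⟩
  qMinus1Sq ⊛ D ⊕ qMinus1Sq ⊛ D′    ≈⟨ ⊛-distribˡ-⊕ qMinus1Sq D D′ ⟨
  qMinus1Sq ⊛ (D ⊕ D′)              ∎
  where
  open ≈-Reasoning
  regroup : ∀ a b c d → a + b - (c + d) ≡ (a - c) + (b - d)
  regroup = solve-∀

⊛-deviation : ∀ U L D U′ L′ D′ → U ⊖ L ≈ qMinus1Sq ⊛ D → U′ ⊖ L′ ≈ qMinus1Sq ⊛ D′ →
              U ⊛ U′ ⊖ L ⊛ L′ ≈ qMinus1Sq ⊛ (U ⊛ D′ ⊕ L′ ⊛ D)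
⊛-deviation U L D U′ L′ D′ h h′ = begin
  U ⊛ U′ ⊖ L ⊛ L′
    ≈⟨ (λ k → telescope ((U ⊛ U′) k) ((U ⊛ L′) k) ((L ⊛ L′) k)) ⟩
  (U ⊛ U′ ⊖ U ⊛ L′) ⊕ (U ⊛ L′ ⊖ L ⊛ L′)
    ≈⟨ ⊕-cong (≈-sym (⊛-distribˡ-⊖ U U′ L′))
              (≈-trans (⊖-cong (⊛-comm U L′) (⊛-comm L L′)) (≈-sym (⊛-distribˡ-⊖ L′ U L))) ⟩
  U ⊛ (U′ ⊖ L′) ⊕ L′ ⊛ (U ⊖ L)
    ≈⟨ ⊕-cong (⊛-cong {U} ≈-refl h′) (⊛-cong {L′} ≈-refl h) ⟩
  U ⊛ (qMinus1Sq ⊛ D′) ⊕ L′ ⊛ (qMinus1Sq ⊛ D)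
    ≈⟨ ⊕-cong (qMinus1Sq-leftComm U D′) (qMinus1Sq-leftComm L′ D) ⟨
  qMinus1Sq ⊛ (U ⊛ D′) ⊕ qMinus1Sq ⊛ (L′ ⊛ D)
    ≈⟨ ⊛-distribˡ-⊕ qMinus1Sq (U ⊛ D′) (L′ ⊛ D) ⟨
  qMinus1Sq ⊛ (U ⊛ D′ ⊕ L′ ⊛ D) ∎
  where
  open ≈-Reasoning
  telescope : ∀ a b c → a - c ≡ (a - b) + (b - c)
  telescope = solve-∀

-- Counting in lists

count : {P : Pred A ℓ} → U.Decidable P → List A → ℕ
count P? xs = length (filter P? xs)

count-++ : {P : Pred A ℓ} (P? : U.Decidable P) (xs ys : List A) →
           count P? (xs ++ ys) ≡ count P? xs ℕ.+ count P? ys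
count-++ P? xs ys = trans (cong length (filter-++ P? xs ys)) (length-++ (filter P? xs))

count-map : {P : Pred A ℓ} (P? : U.Decidable P) (f : B → A) (xs : List B) →
            count P? (map f xs) ≡ count (P? ∘ f) xs
count-map P? f []       = refl
count-map P? f (x ∷ xs) with does (P? (f x))
... | true  = cong suc (count-map P? f xs)
... | false = count-map P? f xs

count-≐ : {P : Pred A ℓ} {Q : Pred A ℓ′} (P? : U.Decidable P) (Q? : U.Decidable Q) →
          P ≐ Q → ∀ xs → count P? xs ≡ count Q? xs
count-≐ P? Q? P≐Q xs = cong length (filter-≐ P? Q? P≐Q xs)

count-none : {P : Pred A ℓ} (P? : U.Decidable P) {xs : List A} → All.All (U.∁ P) xs → count P? xs ≡ 0
count-none P? ¬Ps = cong length (filter-none P? ¬Ps)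

count-∪ : {P : Pred A ℓ} {Q : Pred A ℓ′} (P? : U.Decidable P) (Q? : U.Decidable Q) →
          P ⊥ Q → ∀ xs → count (P? ∪? Q?) xs ≡ count P? xs ℕ.+ count Q? xs
count-∪ P? Q? P⊥Q []       = refl
count-∪ P? Q? P⊥Q (x ∷ xs) with P? x | Q? x
... | yes p | yes q = ⊥-elim (P⊥Q (p , q))
... | yes _ | no _  = cong suc (count-∪ P? Q? P⊥Q xs)
... | no _  | yes _ = trans (cong suc (count-∪ P? Q? P⊥Q xs)) (sym (ℕP.+-suc _ _))
... | no _  | no _  = count-∪ P? Q? P⊥Q xs

count-× : {P : Pred A ℓ} {Q : Pred B ℓ′} (P? : U.Decidable P) (Q? : U.Decidable Q) (xs : List A) (ys : List B) →
          count (P? ×? Q?) (cartesianProduct xs ys) ≡ count P? xs ℕ.* count Q? ys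
count-× P? Q? []       ys = refl
count-× P? Q? (x ∷ xs) ys with P? x
... | yes p = trans (count-++ (P? ×? Q?) (map (x ,_) ys) _)
  (cong₂ ℕ._+_ (trans (count-map (P? ×? Q?) (x ,_) ys) (count-≐ _ Q? (proj₂ , (p ,_)) ys))
               (count-× P? Q? xs ys))
... | no ¬p = trans (count-++ (P? ×? Q?) (map (x ,_) ys) _)
  (cong₂ ℕ._+_ (trans (count-map (P? ×? Q?) (x ,_) ys) (count-none _ (All.universal (λ _ → ¬p ∘ proj₁) ys)))
               (count-× P? Q? xs ys))

count-≟ : (_≟_ : DecidableEquality A) {x : A} {xs : List A} → Unique xs → x ∈ xs → count (_≟ x) xs ≡ 1
count-≟ _≟_ {x} {y ∷ ys} (y∉ys ∷ _) (here refl) with y ≟ y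
... | yes _   = cong suc (count-none (_≟ y) (All.map (λ y≢z z≡y → y≢z (sym z≡y)) y∉ys))
... | no y≢y  = ⊥-elim (y≢y refl)
count-≟ _≟_ {x} {y ∷ ys} (y∉ys ∷ unique) (there x∈ys) with y ≟ x
... | yes refl = ⊥-elim (All.lookup y∉ys x∈ys refl)
... | no _     = count-≟ _≟_ unique x∈ys

-- Counting the neighbours of a point (a, b) of a product that differ from it in
-- exactly one coordinate.
count-cross : {P P′ : Pred A ℓ} {Q Q′ : Pred B ℓ′}
              (P? : U.Decidable P) (P′? : U.Decidable P′) (Q? : U.Decidable Q) (Q′? : U.Decidable Q′) →
              P ⊥ P′ → ∀ xs ys → count P′? xs ≡ 1 → count Q′? ys ≡ 1 →
              count ((P? ×? Q′?) ∪? (P′? ×? Q?)) (cartesianProduct xs ys) ≡ count P? xs ℕ.+ count Q? ys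
count-cross P? P′? Q? Q′? P⊥P′ xs ys one₁ one₂ = begin
  count ((P? ×? Q′?) ∪? (P′? ×? Q?)) (cartesianProduct xs ys)
    ≡⟨ count-∪ (P? ×? Q′?) (P′? ×? Q?) (λ ((p , _) , (p′ , _)) → P⊥P′ (p , p′)) (cartesianProduct xs ys) ⟩
  count (P? ×? Q′?) (cartesianProduct xs ys) ℕ.+ count (P′? ×? Q?) (cartesianProduct xs ys)
    ≡⟨ cong₂ ℕ._+_ (count-× P? Q′? xs ys) (count-× P′? Q? xs ys) ⟩
  count P? xs ℕ.* count Q′? ys ℕ.+ count P′? xs ℕ.* count Q? ys
    ≡⟨ cong₂ (λ m n → count P? xs ℕ.* m ℕ.+ n ℕ.* count Q? ys) one₂ one₁ ⟩
  count P? xs ℕ.* 1 ℕ.+ 1 ℕ.* count Q? ys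
    ≡⟨ cong₂ ℕ._+_ (ℕP.*-identityʳ (count P? xs)) (ℕP.*-identityˡ (count Q? ys)) ⟩
  count P? xs ℕ.+ count Q? ys ∎
  where open ≡-Reasoning

-- Generating polynomials  Σ_{x ∈ xs} q^{f x}

generatingPoly : List A → (A → ℕ) → Poly
generatingPoly xs f k = + count (λ x → f x ℕ.≟ k) xs

generatingPoly-cong : (xs : List A) {f g : A → ℕ} → (∀ x → f x ≡ g x) →
                      generatingPoly xs f ≈ generatingPoly xs g
generatingPoly-cong xs h k =
  cong +_ (count-≐ _ _ ((λ {x} e → trans (sym (h x)) e) , (λ {x} e → trans (h x) e)) xs)

generatingPoly-++ : (xs ys : List A) (f : A → ℕ) →
                    generatingPoly (xs ++ ys) f ≈ generatingPoly xs f ⊕ generatingPoly ys f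
generatingPoly-++ xs ys f k = cong +_ (count-++ _ xs ys)

generatingPoly-map : (g : B → A) (xs : List B) (f : A → ℕ) → generatingPoly (map g xs) f ≈ generatingPoly xs (f ∘ g)
generatingPoly-map g xs f k = cong +_ (count-map _ g xs)

q^-diagonal : ∀ u → (q^ u) u ≡ + 1
q^-diagonal zero    = refl
q^-diagonal (suc u) = q^-diagonal u

q^-offDiagonal : ∀ {u k} → u ≢ k → (q^ u) k ≡ + 0
q^-offDiagonal {zero}  {zero}  u≢k = ⊥-elim (u≢k refl)
q^-offDiagonal {zero}  {suc k} u≢k = refl
q^-offDiagonal {suc u} {zero}  u≢k = refl
q^-offDiagonal {suc u} {suc k} u≢k = q^-offDiagonal (u≢k ∘ cong suc)

generatingPoly-∷ : (x : A) (xs : List A) (f : A → ℕ) → generatingPoly (x ∷ xs) f ≈ q^ (f x) ⊕ generatingPoly xs f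
generatingPoly-∷ x xs f k with f x ℕ.≟ k
... | yes refl = trans (cong (+_ ∘ length) (filter-accept (λ y → f y ℕ.≟ f x) refl))
                       (cong (_+ generatingPoly xs f (f x)) (sym (q^-diagonal (f x))))
... | no fx≢k  = trans (cong (+_ ∘ length) (filter-reject (λ y → f y ℕ.≟ k) fx≢k))
                       (sym (trans (cong (_+ generatingPoly xs f k) (q^-offDiagonal fx≢k)) (ℤP.+-identityˡ _)))

generatingPoly-+ˡ : (xs : List A) (u : ℕ) (g : A → ℕ) → generatingPoly xs (λ x → u ℕ.+ g x) ≈ q^ u ⊛ generatingPoly xs g
generatingPoly-+ˡ []       u g = ≈-sym (⊛-zeroʳ (q^ u))
generatingPoly-+ˡ (x ∷ xs) u g = begin
  generatingPoly (x ∷ xs) (λ x → u ℕ.+ g x)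
    ≈⟨ generatingPoly-∷ x xs (λ x → u ℕ.+ g x) ⟩
  q^ (u ℕ.+ g x) ⊕ generatingPoly xs (λ x → u ℕ.+ g x)
    ≈⟨ ⊕-cong (q^-+ u (g x)) (generatingPoly-+ˡ xs u g) ⟩
  q^ u ⊛ q^ (g x) ⊕ q^ u ⊛ generatingPoly xs g
    ≈⟨ ⊛-distribˡ-⊕ (q^ u) (q^ (g x)) (generatingPoly xs g) ⟨
  q^ u ⊛ (q^ (g x) ⊕ generatingPoly xs g)
    ≈⟨ ⊛-cong {q^ u} ≈-refl (generatingPoly-∷ x xs g) ⟨
  q^ u ⊛ generatingPoly (x ∷ xs) g ∎
  where open ≈-Reasoning

generatingPoly-cartesianProduct : (xs : List A) (ys : List B) (f : A → ℕ) (g : B → ℕ) →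
  generatingPoly (cartesianProduct xs ys) (λ p → f (proj₁ p) ℕ.+ g (proj₂ p)) ≈
  generatingPoly xs f ⊛ generatingPoly ys g
generatingPoly-cartesianProduct []       ys f g = ≈-sym (⊛-zeroˡ (generatingPoly ys g))
generatingPoly-cartesianProduct {A = A} {B = B} (x ∷ xs) ys f g = begin
  generatingPoly (map (x ,_) ys ++ cartesianProduct xs ys) h
    ≈⟨ generatingPoly-++ (map (x ,_) ys) _ h ⟩
  generatingPoly (map (x ,_) ys) h ⊕ generatingPoly (cartesianProduct xs ys) h
    ≈⟨ ⊕-cong (≈-trans (generatingPoly-map (x ,_) ys h) (generatingPoly-+ˡ ys (f x) g))
              (generatingPoly-cartesianProduct xs ys f g) ⟩
  q^ (f x) ⊛ G ⊕ generatingPoly xs f ⊛ G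
    ≈⟨ ⊛-distribʳ-⊕ (q^ (f x)) (generatingPoly xs f) G ⟨
  (q^ (f x) ⊕ generatingPoly xs f) ⊛ G
    ≈⟨ ⊛-cong {r = G} (generatingPoly-∷ x xs f) ≈-refl ⟨
  generatingPoly (x ∷ xs) f ⊛ G ∎
  where
  open ≈-Reasoning
  h : A × B → ℕ
  h p = f (proj₁ p) ℕ.+ g (proj₂ p)
  G : Poly
  G = generatingPoly ys g

module _ (P : FinPoset) where
  open FinPoset P

  count-≟-elems : ∀ x → count (_≟ x) elems ≡ 1
  count-≟-elems x = count-≟ _≟_ unique (complete x)

  count-≟-elems′ : ∀ x → count (x ≟_) elems ≡ 1
  count-≟-elems′ x = trans (count-≐ (x ≟_) (_≟ x) (sym , sym) elems) (count-≟-elems x)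

  ⋖⇒≢ : ∀ {x y} → x ⋖ y → x ≢ y
  ⋖⇒≢ ((_ , x≢y) , _) = x≢y

-- Disjoint union

module _ (P₁ P₂ : FinPoset) where
  private
    module P₁ = FinPoset P₁
    module P₂ = FinPoset P₂
    module Q  = FinPoset (P₁ ⊎ₚ P₂)

  ⋖-inj₁⁺ : ∀ {x y} → x P₁.⋖ y → inj₁ x Q.⋖ inj₁ y
  ⋖-inj₁⁺ ((x≤y , x≢y) , noneBetween) = (x≤y , x≢y ∘ inj₁-injective) , λ where
    (inj₁ z , (x≤z , x≢z) , (z≤y , z≢y)) →
      noneBetween (z , (x≤z , x≢z ∘ cong inj₁) , (z≤y , z≢y ∘ cong inj₁))
    (inj₂ _ , (() , _) , _)

  ⋖-inj₁⁻ : ∀ {x y} → inj₁ x Q.⋖ inj₁ y → x P₁.⋖ y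
  ⋖-inj₁⁻ ((x≤y , x≢y) , noneBetween) = (x≤y , x≢y ∘ cong inj₁) , λ (z , (x≤z , x≢z) , (z≤y , z≢y)) →
    noneBetween (inj₁ z , (x≤z , x≢z ∘ inj₁-injective) , (z≤y , z≢y ∘ inj₁-injective))

  ⋖-inj₂⁺ : ∀ {x y} → x P₂.⋖ y → inj₂ x Q.⋖ inj₂ y
  ⋖-inj₂⁺ ((x≤y , x≢y) , noneBetween) = (x≤y , x≢y ∘ inj₂-injective) , λ where
    (inj₂ z , (x≤z , x≢z) , (z≤y , z≢y)) →
      noneBetween (z , (x≤z , x≢z ∘ cong inj₂) , (z≤y , z≢y ∘ cong inj₂))
    (inj₁ _ , (() , _) , _)

  ⋖-inj₂⁻ : ∀ {x y} → inj₂ x Q.⋖ inj₂ y → x P₂.⋖ y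
  ⋖-inj₂⁻ ((x≤y , x≢y) , noneBetween) = (x≤y , x≢y ∘ cong inj₂) , λ (z , (x≤z , x≢z) , (z≤y , z≢y)) →
    noneBetween (inj₂ z , (x≤z , x≢z ∘ inj₂-injective) , (z≤y , z≢y ∘ inj₂-injective))

  inj₁⋬inj₂ : ∀ {x y} → ¬ (inj₁ x Q.⋖ inj₂ y)
  inj₁⋬inj₂ ((() , _) , _)

  inj₂⋬inj₁ : ∀ {x y} → ¬ (inj₂ x Q.⋖ inj₁ y)
  inj₂⋬inj₁ ((() , _) , _)

  count-⊎ₚ : {R : Pred Q.Carrier ℓ} (R? : U.Decidable R) →
             count R? Q.elems ≡ count (R? ∘ inj₁) P₁.elems ℕ.+ count (R? ∘ inj₂) P₂.elems
  count-⊎ₚ R? = trans (count-++ R? (map inj₁ P₁.elems) (map inj₂ P₂.elems))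
                      (cong₂ ℕ._+_ (count-map R? inj₁ P₁.elems) (count-map R? inj₂ P₂.elems))

  count-⊎ₚ-inj₁ : {R : Pred Q.Carrier ℓ} {R₁ : Pred P₁.Carrier ℓ′}
                  (R? : U.Decidable R) (R₁? : U.Decidable R₁) →
                  (R ∘ inj₁) ≐ R₁ → (∀ y → ¬ R (inj₂ y)) → count R? Q.elems ≡ count R₁? P₁.elems
  count-⊎ₚ-inj₁ R? R₁? R≐R₁ ¬R =
    trans (count-⊎ₚ R?) (trans (cong₂ ℕ._+_ (count-≐ (R? ∘ inj₁) R₁? R≐R₁ P₁.elems)
                                            (count-none (R? ∘ inj₂) (All.universal ¬R P₂.elems)))
                               (ℕP.+-identityʳ (count R₁? P₁.elems)))

  count-⊎ₚ-inj₂ : {R : Pred Q.Carrier ℓ} {R₂ : Pred P₂.Carrier ℓ′}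
                  (R? : U.Decidable R) (R₂? : U.Decidable R₂) →
                  (∀ x → ¬ R (inj₁ x)) → (R ∘ inj₂) ≐ R₂ → count R? Q.elems ≡ count R₂? P₂.elems
  count-⊎ₚ-inj₂ R? R₂? ¬R R≐R₂ =
    trans (count-⊎ₚ R?) (cong₂ ℕ._+_ (count-none (R? ∘ inj₁) (All.universal ¬R P₁.elems))
                                     (count-≐ (R? ∘ inj₂) R₂? R≐R₂ P₂.elems))

  κ-inj₁ : ∀ x → Q.κ (inj₁ x) ≡ P₁.κ x
  κ-inj₁ x = count-⊎ₚ-inj₁ (Q._⋖? inj₁ x) (P₁._⋖? x) (⋖-inj₁⁻ , ⋖-inj₁⁺) (λ _ → inj₂⋬inj₁)

  κ-inj₂ : ∀ x → Q.κ (inj₂ x) ≡ P₂.κ x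
  κ-inj₂ x = count-⊎ₚ-inj₂ (Q._⋖? inj₂ x) (P₂._⋖? x) (λ _ → inj₁⋬inj₂) (⋖-inj₂⁻ , ⋖-inj₂⁺)

  ι-inj₁ : ∀ x → Q.ι (inj₁ x) ≡ P₁.ι x
  ι-inj₁ x = count-⊎ₚ-inj₁ (inj₁ x Q.⋖?_) (x P₁.⋖?_) (⋖-inj₁⁻ , ⋖-inj₁⁺) (λ _ → inj₁⋬inj₂)

  ι-inj₂ : ∀ x → Q.ι (inj₂ x) ≡ P₂.ι x
  ι-inj₂ x = count-⊎ₚ-inj₂ (inj₂ x Q.⋖?_) (x P₂.⋖?_) (λ _ → inj₂⋬inj₁) (⋖-inj₂⁻ , ⋖-inj₂⁺)

  generatingPoly-⊎ₚ : ∀ f → generatingPoly Q.elems f ≈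
                      generatingPoly P₁.elems (f ∘ inj₁) ⊕ generatingPoly P₂.elems (f ∘ inj₂)
  generatingPoly-⊎ₚ f k = cong +_ (count-⊎ₚ (λ x → f x ℕ.≟ k))

  Ku-⊎ₚ : Ku (P₁ ⊎ₚ P₂) ≈ Ku P₁ ⊕ Ku P₂
  Ku-⊎ₚ = ≈-trans (generatingPoly-⊎ₚ Q.κ)
                  (⊕-cong (generatingPoly-cong P₁.elems κ-inj₁) (generatingPoly-cong P₂.elems κ-inj₂))

  Kl-⊎ₚ : Kl (P₁ ⊎ₚ P₂) ≈ Kl P₁ ⊕ Kl P₂
  Kl-⊎ₚ = ≈-trans (generatingPoly-⊎ₚ Q.ι)
                  (⊕-cong (generatingPoly-cong P₁.elems ι-inj₁) (generatingPoly-cong P₂.elems ι-inj₂))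

-- Direct product

module _ (P₁ P₂ : FinPoset) where
  private
    module P₁ = FinPoset P₁
    module P₂ = FinPoset P₂
    module R  = FinPoset (P₁ ×ₚ P₂)
    module O₁ = IsPartialOrder P₁.isPartialOrder
    module O₂ = IsPartialOrder P₂.isPartialOrder

  ⋖-×ₚ⁺ : ∀ {a b a′ b′} → (a P₁.⋖ a′ × b ≡ b′) ⊎ (a ≡ a′ × b P₂.⋖ b′) → (a , b) R.⋖ (a′ , b′)
  ⋖-×ₚ⁺ (inj₁ (((a≤a′ , a≢a′) , noneBetween) , refl)) =
    ((a≤a′ , O₂.refl) , a≢a′ ∘ cong proj₁) , λ ((z , w) , ((a≤z , b≤w) , ≢z) , ((z≤a′ , w≤b) , z≢)) →
      let w≡b = O₂.antisym w≤b b≤w in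
      noneBetween (z , (a≤z , λ e → ≢z (cong₂ _,_ e (sym w≡b))) , (z≤a′ , λ e → z≢ (cong₂ _,_ e w≡b)))
  ⋖-×ₚ⁺ (inj₂ (refl , ((b≤b′ , b≢b′) , noneBetween))) =
    ((O₁.refl , b≤b′) , b≢b′ ∘ cong proj₂) , λ ((z , w) , ((a≤z , b≤w) , ≢w) , ((z≤a , w≤b′) , w≢)) →
      let z≡a = O₁.antisym z≤a a≤z in
      noneBetween (w , (b≤w , λ e → ≢w (cong₂ _,_ (sym z≡a) e)) , (w≤b′ , λ e → w≢ (cong₂ _,_ z≡a e)))

  -- If both coordinates changed, (a′, b) would lie strictly between the two.
  ⋖-×ₚ⁻ : ∀ {a b a′ b′} → (a , b) R.⋖ (a′ , b′) → (a P₁.⋖ a′ × b ≡ b′) ⊎ (a ≡ a′ × b P₂.⋖ b′)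
  ⋖-×ₚ⁻ {a} {b} {a′} {b′} (((a≤a′ , b≤b′) , ≢) , noneBetween) with a P₁.≟ a′ | b P₂.≟ b′
  ... | yes refl | _ = inj₂ (refl , (b≤b′ , ≢ ∘ cong (a ,_)) , λ (w , (b≤w , b≢w) , (w≤b′ , w≢b′)) →
        noneBetween ((a , w) , ((O₁.refl , b≤w) , b≢w ∘ cong proj₂) , ((O₁.refl , w≤b′) , w≢b′ ∘ cong proj₂)))
  ... | no a≢a′ | yes refl = inj₁ (((a≤a′ , a≢a′) , λ (z , (a≤z , a≢z) , (z≤a′ , z≢a′)) →
        noneBetween ((z , b) , ((a≤z , O₂.refl) , a≢z ∘ cong proj₁) , ((z≤a′ , O₂.refl) , z≢a′ ∘ cong proj₁))) , refl)
  ... | no a≢a′ | no b≢b′ = ⊥-elim (noneBetween ((a′ , b) ,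
        ((a≤a′ , O₂.refl) , a≢a′ ∘ cong proj₁) , ((O₁.refl , b≤b′) , b≢b′ ∘ cong proj₂)))

  κ-×ₚ : ∀ a b → R.κ (a , b) ≡ P₁.κ a ℕ.+ P₂.κ b
  κ-×ₚ a b = trans (count-≐ (R._⋖? (a , b)) ((P₁._⋖? a ×? P₂._≟ b) ∪? (P₁._≟ a ×? P₂._⋖? b))
                            (⋖-×ₚ⁻ , ⋖-×ₚ⁺) R.elems)
                   (count-cross (P₁._⋖? a) (P₁._≟ a) (P₂._⋖? b) (P₂._≟ b)
                                (λ (x⋖a , x≡a) → ⋖⇒≢ P₁ x⋖a x≡a) P₁.elems P₂.elems
                                (count-≟-elems P₁ a) (count-≟-elems P₂ b))

  ι-×ₚ : ∀ a b → R.ι (a , b) ≡ P₁.ι a ℕ.+ P₂.ι b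
  ι-×ₚ a b = trans (count-≐ ((a , b) R.⋖?_) ((a P₁.⋖?_ ×? b P₂.≟_) ∪? (a P₁.≟_ ×? b P₂.⋖?_))
                            (⋖-×ₚ⁻ , ⋖-×ₚ⁺) R.elems)
                   (count-cross (a P₁.⋖?_) (a P₁.≟_) (b P₂.⋖?_) (b P₂.≟_)
                                (λ (a⋖x , a≡x) → ⋖⇒≢ P₁ a⋖x a≡x) P₁.elems P₂.elems
                                (count-≟-elems′ P₁ a) (count-≟-elems′ P₂ b))

  Ku-×ₚ : Ku (P₁ ×ₚ P₂) ≈ Ku P₁ ⊛ Ku P₂
  Ku-×ₚ = ≈-trans (generatingPoly-cong R.elems (λ (a , b) → κ-×ₚ a b))
                  (generatingPoly-cartesianProduct P₁.elems P₂.elems P₁.κ P₂.κ)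

  Kl-×ₚ : Kl (P₁ ×ₚ P₂) ≈ Kl P₁ ⊛ Kl P₂
  Kl-×ₚ = ≈-trans (generatingPoly-cong R.elems (λ (a , b) → ι-×ₚ a b))
                  (generatingPoly-cartesianProduct P₁.elems P₂.elems P₁.ι P₂.ι)

-- Deviation polynomials

IsDeviation-unique : ∀ P {D D′} → IsDeviation P D → IsDeviation P D′ → D ≈ D′
IsDeviation-unique _ h h′ = qMinus1Sq-⊛-cancel (≈-trans (≈-sym h) h′)

module _ (P₁ P₂ : FinPoset) (D₁ D₂ : Poly) (h₁ : IsDeviation P₁ D₁) (h₂ : IsDeviation P₂ D₂) where

  IsDeviation-⊎ₚ : IsDeviation (P₁ ⊎ₚ P₂) (D₁ ⊕ D₂)
  IsDeviation-⊎ₚ =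
    ≈-trans (⊖-cong (Ku-⊎ₚ P₁ P₂) (Kl-⊎ₚ P₁ P₂)) (⊕-deviation (Ku P₁) (Kl P₁) D₁ (Ku P₂) (Kl P₂) D₂ h₁ h₂)

  IsDeviation-×ₚ : IsDeviation (P₁ ×ₚ P₂) (Ku P₁ ⊛ D₂ ⊕ Kl P₂ ⊛ D₁)
  IsDeviation-×ₚ =
    ≈-trans (⊖-cong (Ku-×ₚ P₁ P₂) (Kl-×ₚ P₁ P₂)) (⊛-deviation (Ku P₁) (Kl P₁) D₁ (Ku P₂) (Kl P₂) D₂ h₁ h₂)

  IsDeviation-×ₚ′ : IsDeviation (P₁ ×ₚ P₂) (Kl P₁ ⊛ D₂ ⊕ Ku P₂ ⊛ D₁)
  IsDeviation-×ₚ′ = begin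
    Ku (P₁ ×ₚ P₂) ⊖ Kl (P₁ ×ₚ P₂)
      ≈⟨ ⊖-cong (Ku-×ₚ P₁ P₂) (Kl-×ₚ P₁ P₂) ⟩
    Ku P₁ ⊛ Ku P₂ ⊖ Kl P₁ ⊛ Kl P₂
      ≈⟨ ⊖-cong (⊛-comm (Ku P₁) (Ku P₂)) (⊛-comm (Kl P₁) (Kl P₂)) ⟩
    Ku P₂ ⊛ Ku P₁ ⊖ Kl P₂ ⊛ Kl P₁
      ≈⟨ ⊛-deviation (Ku P₂) (Kl P₂) D₂ (Ku P₁) (Kl P₁) D₁ h₂ h₁ ⟩
    qMinus1Sq ⊛ (Ku P₂ ⊛ D₁ ⊕ Kl P₁ ⊛ D₂)
      ≈⟨ ⊛-cong {qMinus1Sq} ≈-refl (⊕-comm (Ku P₂ ⊛ D₁) (Kl P₁ ⊛ D₂)) ⟩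
    qMinus1Sq ⊛ (Kl P₁ ⊛ D₂ ⊕ Ku P₂ ⊛ D₁) ∎
    where open ≈-Reasoning

lemma1p2 : (P₁ P₂ : FinPoset) (D₁ D₂ D₊ D× : Poly) →
    IsDeviation P₁ D₁ → IsDeviation P₂ D₂ →
    IsDeviation (P₁ ⊎ₚ P₂) D₊ → IsDeviation (P₁ ×ₚ P₂) D× →
    (Ku (P₁ ⊎ₚ P₂) ≈ Ku P₁ ⊕ Ku P₂
    × Kl (P₁ ⊎ₚ P₂) ≈ Kl P₁ ⊕ Kl P₂
    × D₊ ≈ D₁ ⊕ D₂)
    × (Ku (P₁ ×ₚ P₂) ≈ Ku P₁ ⊛ Ku P₂
    × Kl (P₁ ×ₚ P₂) ≈ Kl P₁ ⊛ Kl P₂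
    × D× ≈ Ku P₁ ⊛ D₂ ⊕ Kl P₂ ⊛ D₁
    × D× ≈ Kl P₁ ⊛ D₂ ⊕ Ku P₂ ⊛ D₁)
lemma1p2 P₁ P₂ D₁ D₂ D₊ D× h₁ h₂ h₊ h× =
  ( Ku-⊎ₚ P₁ P₂
  , Kl-⊎ₚ P₁ P₂
  , IsDeviation-unique (P₁ ⊎ₚ P₂) h₊ (IsDeviation-⊎ₚ P₁ P₂ D₁ D₂ h₁ h₂) )
  , ( Ku-×ₚ P₁ P₂
    , Kl-×ₚ P₁ P₂
    , IsDeviation-unique (P₁ ×ₚ P₂) h× (IsDeviation-×ₚ P₁ P₂ D₁ D₂ h₁ h₂)
    , IsDeviation-unique (P₁ ×ₚ P₂) h× (IsDeviation-×ₚ′ P₁ P₂ D₁ D₂ h₁ h₂) )
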